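{- Let $\Pi\in\mathcal{C}_\Pi$ with associated constant $c_\Pi$. Let $G$ be a graph and $N^*$ a subneighborhood function of $G$ with $c$-bounded occurrences. Let $M\subseteq V(G)$ be a $c_\Pi$-bundle hitting set of $G$ such that for every $v\in M$, $\mu(G[N(v)]-M)<c_\Pi$. Then for every integer $\tau\ge c_\Pi$ there exists $B\subseteq V(G)$ with $|B|\le \frac{c|M|}{\tau-c_\Pi+1}$ such that $\mu^*(G-B)\le\tau$.
   Context: $\mu(H)$ is the maximum matching size of $H$. A $t$-bundle is a graph consisting of a matching with $t$ edges plus one vertex adjacent to all $2t$ matching vertices; $B\subseteq V(G)$ is a $t$-bundle of $G$ if $G[B]$ is a $t$-bundle possibly with extra edges; a $t$-bundle hitting set intersects every $t$-bundle of $G$. $\mathcal{C}_\Pi$ is the class of hitting problems $\Pi$ (given $G,k$, find $S$ with $|S|\le k$ and $G-S$ in a fixed family) which are minor-bidimensional, solvable in time $\mathrm{tw}(G)^{O(\mathrm{tw}(G))}$, and for which there is an integer $c_\Pi>0$ such that every solution intersects every $c_\Pi$-bundle. A subneighborhood function is $N^*:V(G)\to2^{V(G)}$ with $N^*(v)\subseteq N(v)$; it has $c$-bounded occurrences if each $u$ lies in $N^*(v)$ for at most $c$ vertices $v$. $\mu^*(v)$ is the maximum matching size in $G[N^*(v)]$ and $\mu^*(H)$ the maximum of $\mu^*$ over $V(H)$ (for $G-B$, with $N^*$ restricted to $V(G)\setminus B$). -}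

module Defs where

open import Data.Nat using (ℕ; suc; _≤_; _<_)
open import Data.Fin using (Fin)
open import Data.Fin.Subset using (Subset; _∈_; _∉_; ∣_∣)
open import Data.Vec using (tabulate; lookup)
open import Data.List using (List; []; _∷_; length; concatMap)
open import Data.List.Relation.Unary.All using (All)
open import Data.List.Relation.Unary.Unique.Propositional using (Unique)
open import Data.List.Membership.Propositional using () renaming (_∈_ to _∈ₗ_)
open import Data.Product using (_×_; Σ; ∃; proj₁; proj₂)
open import Relation.Nullary using (¬_)
open import Relation.Binary.PropositionalEquality using (_≡_; _≢_)

record Graph (n : ℕ) : Set₁ where
  field
    Adj    : Fin n → Fin n → Set
    sym    : ∀ {u v} → Adj u v → Adj v u
    irrefl : ∀ {v} → ¬ Adj v v
open Graph public

endpoints : ∀ {n} → List (Fin n × Fin n) → List (Fin n)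
endpoints = concatMap (λ e → proj₁ e ∷ proj₂ e ∷ [])

record Matching {n} (G : Graph n) (S : Fin n → Set) : Set where
  field
    edges    : List (Fin n × Fin n)
    isEdge   : All (λ e → Adj G (proj₁ e) (proj₂ e)) edges
    inside   : All (λ e → S (proj₁ e) × S (proj₂ e)) edges
    disjoint : Unique (endpoints edges)
open Matching public

size : ∀ {n} {G : Graph n} {S : Fin n → Set} → Matching G S → ℕ
size m = length (edges m)

μ≤ : ∀ {n} → Graph n → (Fin n → Set) → ℕ → Set
μ≤ G S t = (m : Matching G S) → size m ≤ t

μ< : ∀ {n} → Graph n → (Fin n → Set) → ℕ → Set
μ< G S t = (m : Matching G S) → size m < t

-- B is a t-bundle of G: G[B] contains a t-bundle as a spanning subgraph, i.e.
-- there is a centre x ∈ B, a matching of t edges of G[B - x] covering all of B - x,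
-- and x is adjacent to every other vertex of B.
IsBundle : ∀ {n} → Graph n → ℕ → Subset n → Set
IsBundle {n} G t B =
  ∃ λ (x : Fin n) → x ∈ B ×
    Σ (Matching G (λ y → y ∈ B × y ≢ x)) (λ m →
        size m ≡ t
      × ((y : Fin n) → y ∈ B → y ≢ x → y ∈ₗ endpoints (edges m))
      × ((y : Fin n) → y ∈ B → y ≢ x → Adj G x y))

BundleHittingSet : ∀ {n} → Graph n → ℕ → Subset n → Set
BundleHittingSet {n} G t M =
  (B : Subset n) → IsBundle G t B → ∃ λ (v : Fin n) → v ∈ B × v ∈ M

IsSubneighborhood : ∀ {n} → Graph n → (Fin n → Subset n) → Set
IsSubneighborhood {n} G Nstar = (v u : Fin n) → u ∈ Nstar v → Adj G v u

occurrences : ∀ {n} → (Fin n → Subset n) → Fin n → Subset n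
occurrences Nstar u = tabulate (λ v → lookup (Nstar v) u)

BoundedOccurrences : ∀ {n} → (Fin n → Subset n) → ℕ → Set
BoundedOccurrences {n} Nstar c = (u : Fin n) → ∣ occurrences Nstar u ∣ ≤ c

μ*≤ : ∀ {n} → Graph n → (Fin n → Subset n) → Subset n → ℕ → Set
μ*≤ {n} G Nstar B τ =
  (v : Fin n) → v ∉ B → μ≤ G (λ u → u ∈ Nstar v × u ∉ B) τ

-- Let B be the vertices v with at least τ − cΠ + 1 vertices of M in N*(v). Counting the pairs
-- (v , u) with u ∈ N*(v) ∩ M, each u occurring for at most c vertices v, bounds |B|.
-- For v ∉ B, a matching of N*(v) − B splits into the edges meeting M, which have distinct
-- endpoints in N*(v) ∩ M and so number at most τ − cΠ, and the edges avoiding M, a matching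
-- of N(v) − M: it has fewer than cΠ edges, by hypothesis if v ∈ M, and otherwise because v
-- together with cΠ of its edges would be a cΠ-bundle missing M.
module Submission where

open import Defs hiding (sym)
open import Data.Nat using (ℕ; zero; suc; _≤_; _<_; _*_; _∸_; _+_; z≤n; s≤s; s≤s⁻¹; _≤?_; _<?_; _≤ᵇ_)
open import Data.Nat.Properties
open import Algebra.Properties.Semiring.Sum +-*-semiring
  using (sum; sum-cong-≗; ∑-comm; *-distribˡ-sum; *-distribʳ-sum)
open import Data.Bool using (true; false; if_then_else_)
open import Data.Fin using (Fin; zero; suc)
open import Data.Fin.Subset
  using (Subset; _∈_; _∉_; ∣_∣; _∩_; _∪_; ⁅_⁆; _-_) renaming (⊥ to ∅)
open import Data.Fin.Subset.Properties
  using (_∈?_; x∈p∩q⁺; x∈p∪q⁺; x∈p∪q⁻; x∈⁅x⁆; x∈⁅y⁆⇒x≡y; ∉⊥; x≢y⇒x∉⁅y⁆; x∈p∧x∉q⇒x∈p─q; x∈p⇒∣p-x∣<∣p∣)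
open import Data.Vec using ([]; _∷_; lookup; tabulate)
open import Data.Vec.Properties using (lookup∘tabulate; lookup⇒[]=)
open import Data.List using (List; []; _∷_; length; take; filter; foldr)
open import Data.List.Properties using (length-take)
open import Data.List.Relation.Unary.All as All using (All; []; _∷_)
open import Data.List.Relation.Unary.All.Properties using (all-filter) renaming (filter⁺ to All-filter⁺)
open import Data.List.Relation.Unary.Any using (here; there)
open import Data.List.Relation.Unary.AllPairs using ([]; _∷_)
open import Data.List.Relation.Unary.Unique.Propositional using (Unique)
open import Data.List.Membership.Propositional using () renaming (_∈_ to _∈ₗ_)
open import Data.List.Relation.Binary.Sublist.Propositional using (_⊆_; []; _∷_; _∷ʳ_; ⊆-refl)
open import Data.List.Relation.Binary.Sublist.Propositional.Properties using (All-resp-⊆; take-⊆; filter-⊆)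
open import Data.Product using (_×_; Σ; ∃; _,_; proj₁; proj₂)
open import Data.Sum using (_⊎_; inj₁; inj₂)
import Data.Sum as Sum
open import Data.Empty using (⊥-elim)
open import Relation.Nullary using (¬_; yes; no; does; _⊎-dec_; ofʸ)
open import Relation.Nullary.Decidable using (dec-true)
open import Relation.Unary using (Decidable)
open import Relation.Unary.Properties using (∁?)
open import Relation.Binary.PropositionalEquality using (_≡_; _≢_; refl; sym; trans; cong; subst; ≢-sym)
open import Function using (_∘_)

private
  variable
    n t : ℕ

indicator : Subset n → Fin n → ℕ
indicator p u = if lookup p u then 1 else 0

∣p∣≡∑indicator : (p : Subset n) → ∣ p ∣ ≡ sum (indicator p)
∣p∣≡∑indicator []          = refl
∣p∣≡∑indicator (true  ∷ p) = cong suc (∣p∣≡∑indicator p)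
∣p∣≡∑indicator (false ∷ p) = ∣p∣≡∑indicator p

∣p∩q∣≡∑indicator* : (p q : Subset n) → ∣ p ∩ q ∣ ≡ sum (λ u → indicator p u * indicator q u)
∣p∩q∣≡∑indicator* []          []          = refl
∣p∩q∣≡∑indicator* (true  ∷ p) (true  ∷ q) = cong suc (∣p∩q∣≡∑indicator* p q)
∣p∩q∣≡∑indicator* (true  ∷ p) (false ∷ q) = ∣p∩q∣≡∑indicator* p q
∣p∩q∣≡∑indicator* (false ∷ p) (true  ∷ q) = ∣p∩q∣≡∑indicator* p q
∣p∩q∣≡∑indicator* (false ∷ p) (false ∷ q) = ∣p∩q∣≡∑indicator* p q

sum-mono-≤ : {f g : Fin n → ℕ} → (∀ i → f i ≤ g i) → sum f ≤ sum g
sum-mono-≤ {zero}  f≤g = z≤n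
sum-mono-≤ {suc n} f≤g = +-mono-≤ (f≤g zero) (sum-mono-≤ (f≤g ∘ suc))

atLeast : ℕ → (Fin n → ℕ) → Subset n
atLeast k f = tabulate (λ v → does (k ≤? f v))

∣atLeast∣*k≤∑ : ∀ k (f : Fin n → ℕ) → ∣ atLeast k f ∣ * k ≤ sum f
∣atLeast∣*k≤∑ {zero}  k f = z≤n
∣atLeast∣*k≤∑ {suc n} k f with k ≤ᵇ f zero | ≤ᵇ-reflects-≤ k (f zero)
... | true  | ofʸ k≤f₀ = +-mono-≤ k≤f₀ (∣atLeast∣*k≤∑ k (f ∘ suc))
... | false | _        = ≤-trans (∣atLeast∣*k≤∑ k (f ∘ suc)) (m≤n+m _ (f zero))

∉atLeast⇒< : ∀ {k} {f : Fin n → ℕ} {v} → v ∉ atLeast k f → f v < k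
∉atLeast⇒< {k = k} {f} {v} v∉ = ≰⇒> λ k≤fv →
  v∉ (lookup⇒[]= v _ (trans (lookup∘tabulate _ v) (dec-true (k ≤? f v) k≤fv)))

∣occurrences∣≡∑ : (N : Fin n → Subset n) (u : Fin n) →
  ∣ occurrences N u ∣ ≡ sum (λ v → indicator (N v) u)
∣occurrences∣≡∑ N u = trans (∣p∣≡∑indicator (occurrences N u))
  (sum-cong-≗ λ v → cong (λ b → if b then 1 else 0) (lookup∘tabulate (λ v → lookup (N v) u) v))

∑∣N∩M∣≤c*∣M∣ : ∀ {c} (N : Fin n → Subset n) → BoundedOccurrences N c →
  (M : Subset n) → sum (λ v → ∣ N v ∩ M ∣) ≤ c * ∣ M ∣
∑∣N∩M∣≤c*∣M∣ {c = c} N bounded M = begin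
    sum (λ v → ∣ N v ∩ M ∣)
  ≡⟨ sum-cong-≗ (λ v → ∣p∩q∣≡∑indicator* (N v) M) ⟩
    sum (λ v → sum (λ u → indicator (N v) u * indicator M u))
  ≡⟨ ∑-comm (λ v u → indicator (N v) u * indicator M u) ⟩
    sum (λ u → sum (λ v → indicator (N v) u * indicator M u))
  ≡⟨ sum-cong-≗ (λ u → *-distribʳ-sum (indicator M u) (λ v → indicator (N v) u)) ⟨
    sum (λ u → sum (λ v → indicator (N v) u) * indicator M u)
  ≡⟨ sum-cong-≗ (λ u → cong (_* indicator M u) (∣occurrences∣≡∑ N u)) ⟨
    sum (λ u → ∣ occurrences N u ∣ * indicator M u)
  ≤⟨ sum-mono-≤ (λ u → *-monoˡ-≤ (indicator M u) (bounded u)) ⟩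
    sum (λ u → c * indicator M u)
  ≡⟨ *-distribˡ-sum c (indicator M) ⟨
    c * sum (indicator M)
  ≡⟨ cong (c *_) (∣p∣≡∑indicator M) ⟨
    c * ∣ M ∣
  ∎
  where open ≤-Reasoning

Edge : ℕ → Set
Edge n = Fin n × Fin n

Covers : Subset n → Edge n → Set
Covers P (a , b) = a ∈ P ⊎ b ∈ P

covers? : (P : Subset n) → Decidable (Covers P)
covers? P (a , b) = (a ∈? P) ⊎-dec (b ∈? P)

BothEnds : (Fin n → Set) → Edge n → Set
BothEnds S (a , b) = S a × S b

All-endpoints⁺ : ∀ {S : Fin n → Set} {es} → All (BothEnds S) es → All S (endpoints es)
All-endpoints⁺ []              = []
All-endpoints⁺ ((sa , sb) ∷ s) = sa ∷ sb ∷ All-endpoints⁺ s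

All-endpoints⁻ : ∀ {S : Fin n → Set} es → All S (endpoints es) → All (BothEnds S) es
All-endpoints⁻ []       []             = []
All-endpoints⁻ (_ ∷ es) (sa ∷ sb ∷ s) = (sa , sb) ∷ All-endpoints⁻ es s

endpoints-⊆ : {es fs : List (Edge n)} → es ⊆ fs → endpoints es ⊆ endpoints fs
endpoints-⊆ []           = []
endpoints-⊆ (_ ∷ʳ sub)   = _ ∷ʳ (_ ∷ʳ endpoints-⊆ sub)
endpoints-⊆ (refl ∷ sub) = refl ∷ (refl ∷ endpoints-⊆ sub)

Unique-resp-⊆ : ∀ {A : Set} {xs ys : List A} → xs ⊆ ys → Unique ys → Unique xs
Unique-resp-⊆ []           []       = []
Unique-resp-⊆ (_ ∷ʳ sub)   (_ ∷ u)  = Unique-resp-⊆ sub u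
Unique-resp-⊆ (refl ∷ sub) (x∉ ∷ u) = All-resp-⊆ sub x∉ ∷ Unique-resp-⊆ sub u

length-filter+filter-∁ : ∀ {A : Set} {P : A → Set} (P? : Decidable P) xs →
  length xs ≡ length (filter P? xs) + length (filter (∁? P?) xs)
length-filter+filter-∁ P? []       = refl
length-filter+filter-∁ P? (x ∷ xs) with P? x
... | yes _ = cong suc (length-filter+filter-∁ P? xs)
... | no  _ = trans (cong suc (length-filter+filter-∁ P? xs)) (sym (+-suc _ _))

Covers-─ : ∀ {P : Subset n} {x} es → All (x ≢_) (endpoints es) → All (Covers P) es →
  All (Covers (P - x)) es
Covers-─ []       []               []       = []
Covers-─ (_ ∷ es) (x≢a ∷ x≢b ∷ x∉) (c ∷ cs) =
  Sum.map (keep x≢a) (keep x≢b) c ∷ Covers-─ es x∉ cs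
  where
  keep : ∀ {P x y} → x ≢ y → y ∈ P → y ∈ P - x
  keep x≢y y∈P = x∈p∧x∉q⇒x∈p─q y∈P (x≢y⇒x∉⁅y⁆ (≢-sym x≢y))

-- A matching is no larger than a vertex cover: the covering endpoint of the first edge is
-- removed from the cover, and the remaining edges are still covered since they avoid it.
length≤∣cover∣ : {P : Subset n} (es : List (Edge n)) →
  Unique (endpoints es) → All (Covers P) es → length es ≤ ∣ P ∣
length≤∣cover∣ []       _                       _               = z≤n
length≤∣cover∣ (_ ∷ es) ((_ ∷ a∉es) ∷ _ ∷ u) (inj₁ a∈P ∷ cs) =
  ≤-trans (s≤s (length≤∣cover∣ es u (Covers-─ es a∉es cs))) (x∈p⇒∣p-x∣<∣p∣ a∈P)
length≤∣cover∣ (_ ∷ es) (_ ∷ b∉es ∷ u)        (inj₂ b∈P ∷ cs) =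
  ≤-trans (s≤s (length≤∣cover∣ es u (Covers-─ es b∉es cs))) (x∈p⇒∣p-x∣<∣p∣ b∈P)

fromList : List (Fin n) → Subset n
fromList = foldr (λ x p → ⁅ x ⁆ ∪ p) ∅

∈fromList⁺ : ∀ {x : Fin n} xs → x ∈ₗ xs → x ∈ fromList xs
∈fromList⁺ (x ∷ _)  (here refl) = x∈p∪q⁺ (inj₁ (x∈⁅x⁆ x))
∈fromList⁺ (_ ∷ xs) (there x∈)  = x∈p∪q⁺ (inj₂ (∈fromList⁺ xs x∈))

∈fromList⁻ : ∀ {x : Fin n} xs → x ∈ fromList xs → x ∈ₗ xs
∈fromList⁻ []       x∈ = ⊥-elim (∉⊥ x∈)
∈fromList⁻ (y ∷ xs) x∈ with x∈p∪q⁻ ⁅ y ⁆ (fromList xs) x∈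
... | inj₁ x∈⁅y⁆ = here (x∈⁅y⁆⇒x≡y y x∈⁅y⁆)
... | inj₂ x∈xs  = there (∈fromList⁻ xs x∈xs)

module _ {n} (G : Graph n) where

  subMatching : ∀ {S T : Fin n → Set} (m : Matching G S) {es} → es ⊆ edges m →
    All (BothEnds T) es → Matching G T
  subMatching m {es} sub inT = record
    { edges    = es
    ; isEdge   = All-resp-⊆ sub (isEdge m)
    ; inside   = inT
    ; disjoint = Unique-resp-⊆ (endpoints-⊆ sub) (disjoint m)
    }

  truncate : ∀ {S} → ℕ → Matching G S → Matching G S
  truncate t m = subMatching m (take-⊆ t (edges m)) (All-resp-⊆ (take-⊆ t (edges m)) (inside m))

  size-truncate : ∀ {S} (m : Matching G S) → t ≤ size m → size (truncate t m) ≡ t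
  size-truncate {t = t} m t≤m = trans (length-take t (edges m)) (m≤n⇒m⊓n≡m t≤m)

  μ<-anti : ∀ {S T : Fin n → Set} → (∀ {u} → S u → T u) → μ< G T t → μ< G S t
  μ<-anti S⊆T μ<T m = μ<T (subMatching m ⊆-refl (All.map (λ (sa , sb) → S⊆T sa , S⊆T sb) (inside m)))

  matching⇒bundle : ∀ {S v} (m : Matching G S) → (∀ {u} → S u → Adj G v u) →
    IsBundle G (size m) (fromList (v ∷ endpoints (edges m)))
  matching⇒bundle {v = v} m S⊆N = v , ∈fromList⁺ vs (here refl) , m′ , refl , covered , adjacent
    where
    vs = v ∷ endpoints (edges m)
    B = fromList vs
    adj : All (Adj G v) (endpoints (edges m))
    adj = All.map S⊆N (All-endpoints⁺ (inside m))
    m′ : Matching G (λ y → y ∈ B × y ≢ v)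
    m′ = subMatching m ⊆-refl (All-endpoints⁻ (edges m) (All.tabulate λ y∈ →
           ∈fromList⁺ vs (there y∈) , λ { refl → irrefl G (All.lookup adj y∈) }))
    covered : ∀ y → y ∈ B → y ≢ v → y ∈ₗ endpoints (edges m)
    covered y y∈B y≢v with ∈fromList⁻ vs y∈B
    ... | here y≡v = ⊥-elim (y≢v y≡v)
    ... | there y∈ = y∈
    adjacent : ∀ y → y ∈ B → y ≢ v → Adj G v y
    adjacent y y∈B y≢v = All.lookup adj (covered y y∈B y≢v)

  hitting⇒μ< : ∀ {M v} → BundleHittingSet G t M → v ∉ M → μ< G (λ u → Adj G v u × u ∉ M) t
  hitting⇒μ< {t = t} {M} {v} hit v∉M m with size m <? t
  ... | yes m<t = m<t
  ... | no  m≮t = ⊥-elim (avoids (hit B bundle))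
    where
    m′ = truncate t m
    B = fromList (v ∷ endpoints (edges m′))
    bundle : IsBundle G t B
    bundle = subst (λ s → IsBundle G s B) (size-truncate m (≮⇒≥ m≮t)) (matching⇒bundle m′ proj₁)
    avoids : ¬ ∃ λ w → w ∈ B × w ∈ M
    avoids (w , w∈B , w∈M) with ∈fromList⁻ (v ∷ endpoints (edges m′)) w∈B
    ... | here refl = v∉M w∈M
    ... | there w∈  = proj₂ (All.lookup (All-endpoints⁺ (inside m′)) w∈) w∈M

  size≤∣Q∩P∣+residual : ∀ {S} (P Q : Subset n) → (∀ {u} → S u → u ∈ Q) → (m : Matching G S) →
    Σ (Matching G (λ u → S u × u ∉ P)) λ m′ → size m ≤ ∣ Q ∩ P ∣ + size m′
  size≤∣Q∩P∣+residual {S} P Q S⊆Q m = m′ , (begin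
      size m                   ≡⟨ length-filter+filter-∁ (covers? P) (edges m) ⟩
      length covered + size m′ ≤⟨ +-monoˡ-≤ (size m′) (length≤∣cover∣ covered unique Q∩P-covers) ⟩
      ∣ Q ∩ P ∣ + size m′      ∎)
    where
    open ≤-Reasoning
    covered = filter (covers? P) (edges m)
    unique : Unique (endpoints covered)
    unique = Unique-resp-⊆ (endpoints-⊆ (filter-⊆ (covers? P) (edges m))) (disjoint m)
    Q∩P-covers : All (Covers (Q ∩ P)) covered
    Q∩P-covers = All.zipWith
      (λ ((sa , sb) , c) → Sum.map (λ a∈P → x∈p∩q⁺ (S⊆Q sa , a∈P)) (λ b∈P → x∈p∩q⁺ (S⊆Q sb , b∈P)) c)
      (All-filter⁺ (covers? P) (inside m) , all-filter (covers? P) (edges m))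
    m′ : Matching G (λ u → S u × u ∉ P)
    m′ = subMatching m (filter-⊆ (∁? (covers? P)) (edges m)) (All.zipWith
      (λ ((sa , sb) , ¬c) → (sa , ¬c ∘ inj₁) , (sb , ¬c ∘ inj₂))
      (All-filter⁺ (∁? (covers? P)) (inside m) , all-filter (∁? (covers? P)) (edges m)))

  μ*≤-via-cover : ∀ {Nstar M B s} → IsSubneighborhood G Nstar →
    (∀ v → μ< G (λ u → Adj G v u × u ∉ M) t) → (∀ v → v ∉ B → ∣ Nstar v ∩ M ∣ ≤ s) →
    μ*≤ G Nstar B (s + t)
  μ*≤-via-cover {Nstar = Nstar} {M} Nsub μ<N∖M few v v∉B m =
    let m′ , m≤ = size≤∣Q∩P∣+residual M (Nstar v) proj₁ m
        m′<t    = μ<-anti (λ ((u∈N , _) , u∉M) → Nsub v _ u∈N , u∉M) (μ<N∖M v) m′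
    in ≤-trans m≤ (+-mono-≤ (few v v∉B) (<⇒≤ m′<t))

lemma13 : ∀ {n} (G : Graph n) (cΠ c : ℕ) → 1 ≤ cΠ
    → (Nstar : Fin n → Subset n) → IsSubneighborhood G Nstar → BoundedOccurrences Nstar c
    → (M : Subset n) → BundleHittingSet G cΠ M
    → ((v : Fin n) → v ∈ M → μ< G (λ u → Adj G v u × u ∉ M) cΠ)
    → (τ : ℕ) → cΠ ≤ τ
    → ∃ λ (B : Subset n) → ∣ B ∣ * suc (τ ∸ cΠ) ≤ c * ∣ M ∣ × μ*≤ G Nstar B τ
lemma13 G cΠ c _ Nstar Nsub occ M hit μ<M τ cΠ≤τ = B , B-small , μ*≤τ
  where
  degM : Fin _ → ℕ
  degM v = ∣ Nstar v ∩ M ∣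
  B = atLeast (suc (τ ∸ cΠ)) degM
  B-small = ≤-trans (∣atLeast∣*k≤∑ _ degM) (∑∣N∩M∣≤c*∣M∣ Nstar occ M)
  μ<N∖M : ∀ v → μ< G (λ u → Adj G v u × u ∉ M) cΠ
  μ<N∖M v with v ∈? M
  ... | yes v∈M = μ<M v v∈M
  ... | no  v∉M = hitting⇒μ< G hit v∉M
  μ*≤τ = subst (μ*≤ G Nstar B) (m∸n+n≡m cΠ≤τ)
           (μ*≤-via-cover G Nsub μ<N∖M (λ v v∉B → s≤s⁻¹ (∉atLeast⇒< {f = degM} v∉B)))
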